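{- Let $\mathbf s$ be a quasi-Sturmian word and let $W$ be a nonempty finite word that is a factor of $\mathbf s$. Then there exists a positive integer $t$ such that the word $W^t$ is not a factor of $\mathbf s$.
   Context: For an infinite word $\mathbf x = x_1 x_2 \ldots$ over a finite alphabet and a positive integer $n$, let $p(n,\mathbf x) = \mathrm{Card}\{x_{j+1}\ldots x_{j+n} : j \ge 0\}$. An infinite word $\mathbf x$ is quasi-Sturmian if there are positive integers $k$ and $n_0$ such that $p(n,\mathbf x) = n+k$ for all $n \ge n_0$. A factor of $\mathbf x$ is a finite word of the form $x_{j+1}\ldots x_{j+n}$. For a finite word $W$ and a positive integer $t$, $W^t$ denotes the concatenation of $t$ copies of $W$. -}

module Defs where

open import Data.Nat using (ℕ; zero; suc; _+_; _≤_; _<_)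
open import Data.Fin using (Fin)
open import Data.List using (List; []; _∷_; length; concat; replicate)
open import Data.List.Membership.Propositional using (_∈_)
open import Data.List.Relation.Unary.Unique.Propositional using (Unique)
open import Data.Product using (Σ; ∃; _×_; _,_)
open import Relation.Binary.PropositionalEquality using (_≡_)

-- An infinite word over the finite alphabet Fin m; x i is the letter x_{i+1}.
InfWord : ℕ → Set
InfWord m = ℕ → Fin m

factorAt : {m : ℕ} → InfWord m → ℕ → ℕ → List (Fin m)
factorAt x j zero    = []
factorAt x j (suc n) = x j ∷ factorAt x (suc j) n

IsFactor : {m : ℕ} → List (Fin m) → InfWord m → Set
IsFactor {m} W x = ∃ λ j → factorAt x j (length W) ≡ W

-- p(n, x) = c : the set of factors of length n has exactly c elements,
-- witnessed by a duplicate-free list enumerating exactly those factors.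
ComplexityIs : {m : ℕ} → InfWord m → ℕ → ℕ → Set
ComplexityIs {m} x n c =
  Σ (List (List (Fin m))) λ L →
    Unique L
    × (∀ w → w ∈ L → ∃ λ j → factorAt x j n ≡ w)
    × (∀ j → factorAt x j n ∈ L)
    × length L ≡ c

QuasiSturmian : {m : ℕ} → InfWord m → Set
QuasiSturmian x =
  ∃ λ k → ∃ λ n₀ → (1 ≤ k) × (1 ≤ n₀) × (∀ n → n₀ ≤ n → ComplexityIs x n (n + k))

_^^_ : {A : Set} → List A → ℕ → List A
W ^^ t = concat (replicate t W)

{-# OPTIONS --safe #-}
module Submission where

-- Let ℓ = |W|. An occurrence of W^(t+1) at j means that the factors of length |W^t| at j and at
-- j + ℓ coincide: s has an ℓ-periodic stretch of length |W^t| + ℓ. Since p(n+1) = p(n) + 1 for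
-- n ≥ n₀, every such length has a unique right special factor. Inside a long ℓ-periodic stretch
-- every right special factor of admissible length is itself ℓ-periodic: otherwise an ℓ-periodic
-- window failing to continue its period would be a second right special factor, and if no window
-- fails then s is eventually periodic and has bounded complexity. Hence a factor u of length
-- n₀ + ℓ + 1 whose letters at n₀ and n₀ + ℓ differ is never right special, so any two of its
-- occurrences extend identically for as long as the stretch allows. As s is not eventually
-- ℓ-periodic, such a u occurs at some z beyond the bound on first occurrences, with z − q₀
-- bounded for an earlier occurrence q₀; for a long enough stretch this makes s eventually
-- (z − q₀)-periodic, a contradiction.

open import Defs
open import Data.Nat using (ℕ; zero; suc; _+_; _*_; _∸_; _≤_; _<_; z≤n; s≤s; s≤s⁻¹; z<s; _⊔_; _<?_; NonZero; >-nonZero)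
open import Data.Nat.Properties hiding (_≟_)
open import Data.Nat.DivMod using (_%_; _/_; m≡m%n+[m/n]*n; m%n<n)
open import Data.Nat.Induction using (<-rec)
open import Algebra.Properties.CommutativeSemigroup +-commutativeSemigroup using (xy∙z≈xz∙y)
open import Data.List using (List; []; _∷_; length; _++_; _∷ʳ_; map; upTo)
open import Data.List.Properties using (length-++; length-removeAt′; ++-assoc; ++-identityʳ; ∷-injective; ∷ʳ-injective; ∷ʳ-injectiveˡ; length-map; length-upTo; ≡-dec)
open import Data.List.Membership.Propositional using (_∈_; _∉_)
open import Data.List.Membership.Propositional.Properties using (∈-map⁺; ∈-map⁻; ∈-upTo⁺)
open import Data.List.Relation.Unary.Any using (here; there; index; _─_)
open import Data.List.Relation.Unary.All using (_∷_) renaming (lookup to All-lookup)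
open import Data.List.Relation.Unary.All.Properties.Core using (¬Any⇒All¬)
open import Data.List.Relation.Unary.AllPairs using (_∷_)
open import Data.List.Relation.Unary.Unique.Propositional using (Unique)
open import Data.List.Relation.Unary.Unique.Propositional.Properties using (map⁺)
open import Data.Fin using (Fin; _≟_)
open import Data.Product using (∃; _×_; _,_; proj₁; proj₂)
open import Data.Empty using (⊥)
open import Function using (_∘_)
open import Relation.Nullary using (¬_; yes; no; contradiction)
open import Relation.Nullary.Decidable using (decidable-stable; ¬?)
open import Relation.Binary.PropositionalEquality

∈-─ : {A : Set} {x z : A} {ys : List A} (x∈ys : x ∈ ys) → z ≢ x → z ∈ ys → z ∈ (ys ─ x∈ys)
∈-─ (here refl) z≢x (here refl) = contradiction refl z≢x
∈-─ (here refl) _   (there z∈ys) = z∈ys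
∈-─ (there _)   _   (here refl) = here refl
∈-─ (there x∈ys) z≢x (there z∈ys) = there (∈-─ x∈ys z≢x z∈ys)

Unique-⊆⇒length≤ : {A : Set} {xs ys : List A} → Unique xs → (∀ {z} → z ∈ xs → z ∈ ys) → length xs ≤ length ys
Unique-⊆⇒length≤ {xs = []} _ _ = z≤n
Unique-⊆⇒length≤ {xs = x ∷ xs} {ys} (x∉xs ∷ xs-unique) xs⊆ys =
  subst (suc (length xs) ≤_) (sym (length-removeAt′ ys (index x∈ys)))
    (s≤s (Unique-⊆⇒length≤ xs-unique λ z∈xs → ∈-─ x∈ys (≢-sym (All-lookup x∉xs z∈xs)) (xs⊆ys (there z∈xs))))
  where
  x∈ys : x ∈ ys
  x∈ys = xs⊆ys (here refl)

witnesses-bounded : {A : Set} {P : ℕ → A → Set} (xs : List A) → (∀ {x} → x ∈ xs → ∃ λ j → P j x) →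
                    ∃ λ B → ∀ {x} → x ∈ xs → ∃ λ j → j ≤ B × P j x
witnesses-bounded [] _ = 0 , λ ()
witnesses-bounded (x ∷ xs) wit with wit (here refl) | witnesses-bounded xs (wit ∘ there)
... | j , Pj | B , bounded = j ⊔ B , λ
  { (here refl) → j , m≤m⊔n j B , Pj
  ; (there x∈xs) → let i , i≤B , Pi = bounded x∈xs in i , ≤-trans i≤B (m≤n⊔m j B) , Pi }

^^-suc : {A : Set} (W : List A) (t : ℕ) → W ^^ suc t ≡ W ^^ t ++ W
^^-suc W zero = ++-identityʳ W
^^-suc W (suc t) = trans (cong (W ++_) (^^-suc W t)) (sym (++-assoc W (W ^^ t) W))

length-^^ : {A : Set} (W : List A) (t : ℕ) → length (W ^^ t) ≡ t * length W
length-^^ W zero = refl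
length-^^ W (suc t) = trans (length-++ W) (cong (length W +_) (length-^^ W t))

private variable
  a a' b j p p' q q' i n n' ℓ c L Q P : ℕ

module _ {m : ℕ} (s : InfWord m) where

  PeriodAt : ℕ → ℕ → Set
  PeriodAt ℓ x = s (x + ℓ) ≡ s x

  PeriodicFrom : ℕ → ℕ → Set
  PeriodicFrom Q ℓ = ∀ x → Q ≤ x → PeriodAt ℓ x

  RightSpecial : ℕ → ℕ → ℕ → Set
  RightSpecial n q q' = factorAt s q n ≡ factorAt s q' n × s (q + n) ≢ s (q' + n)

  factorAt-suc : ∀ q n → factorAt s q (suc n) ≡ factorAt s q n ∷ʳ s (q + n)
  factorAt-suc q zero    = cong (λ x → s x ∷ []) (sym (+-identityʳ q))
  factorAt-suc q (suc n) = cong (s q ∷_) (trans (factorAt-suc (suc q) n) (cong (λ x → factorAt s (suc q) n ∷ʳ s x) (sym (+-suc q n))))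

  factorAt-≡⇒letter-≡ : ∀ n → factorAt s q n ≡ factorAt s q' n → i < n → s (q + i) ≡ s (q' + i)
  factorAt-≡⇒letter-≡ {q = q} {q' = q'} {i = zero} (suc n) eq _ =
    trans (cong s (+-identityʳ q)) (trans (proj₁ (∷-injective eq)) (cong s (sym (+-identityʳ q'))))
  factorAt-≡⇒letter-≡ {q = q} {q' = q'} {i = suc i} (suc n) eq (s≤s i<n) =
    trans (cong s (+-suc q i)) (trans (factorAt-≡⇒letter-≡ n (proj₂ (∷-injective eq)) i<n) (cong s (sym (+-suc q' i))))

  letter-≡⇒factorAt-≡ : ∀ n → (∀ i → i < n → s (q + i) ≡ s (q' + i)) → factorAt s q n ≡ factorAt s q' n
  letter-≡⇒factorAt-≡ zero _ = refl
  letter-≡⇒factorAt-≡ {q = q} {q' = q'} (suc n) same = cong₂ _∷_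
    (trans (cong s (sym (+-identityʳ q))) (trans (same 0 z<s) (cong s (+-identityʳ q'))))
    (letter-≡⇒factorAt-≡ n λ i i<n →
      trans (cong s (sym (+-suc q i))) (trans (same (suc i) (s≤s i<n)) (cong s (+-suc q' i))))

  factorAt-≡-infix : factorAt s q n ≡ factorAt s q' n → i + n' ≤ n → factorAt s (q + i) n' ≡ factorAt s (q' + i) n'
  factorAt-≡-infix {q = q} {n = n} {q' = q'} {i = i} {n' = n'} eq i+n'≤n = letter-≡⇒factorAt-≡ n' λ i' i'<n' →
    trans (cong s (+-assoc q i i'))
      (trans (factorAt-≡⇒letter-≡ n eq (≤-trans (+-monoʳ-< i i'<n') i+n'≤n)) (cong s (sym (+-assoc q' i i'))))

  factorAt-++ : ∀ (U V : List (Fin m)) j → factorAt s j (length (U ++ V)) ≡ U ++ V →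
                factorAt s j (length U) ≡ U × factorAt s (j + length U) (length V) ≡ V
  factorAt-++ [] V j eq = refl , subst (λ x → factorAt s x (length V) ≡ V) (sym (+-identityʳ j)) eq
  factorAt-++ (u ∷ U) V j eq with factorAt-++ U V (suc j) (proj₂ (∷-injective eq))
  ... | eqU , eqV = cong₂ _∷_ (proj₁ (∷-injective eq)) eqU
                  , subst (λ x → factorAt s x (length V) ≡ V) (sym (+-suc j (length U))) eqV

  shift-invariant⇒PeriodAt : factorAt s p n ≡ factorAt s (p + ℓ) n → i < n → PeriodAt ℓ (p + i)
  shift-invariant⇒PeriodAt {p = p} {n = n} {ℓ = ℓ} {i = i} eq i<n =
    trans (cong s (xy∙z≈xz∙y p i ℓ)) (sym (factorAt-≡⇒letter-≡ n eq i<n))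

  PeriodAt-transfer : factorAt s a n ≡ factorAt s b n → i + ℓ < n → PeriodAt ℓ (b + i) → PeriodAt ℓ (a + i)
  PeriodAt-transfer {a = a} {n = n} {b = b} {i = i} {ℓ = ℓ} eq i+ℓ<n period = begin
    s (a + i + ℓ)   ≡⟨ cong s (+-assoc a i ℓ) ⟩
    s (a + (i + ℓ)) ≡⟨ factorAt-≡⇒letter-≡ n eq i+ℓ<n ⟩
    s (b + (i + ℓ)) ≡⟨ cong s (sym (+-assoc b i ℓ)) ⟩
    s (b + i + ℓ)   ≡⟨ period ⟩
    s (b + i)       ≡⟨ sym (factorAt-≡⇒letter-≡ n eq (≤-trans (s≤s (m≤m+n i ℓ)) i+ℓ<n)) ⟩
    s (a + i)       ∎
    where open ≡-Reasoning

  factor-positions-bounded : ComplexityIs s n c →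
                             ∃ λ B → ∀ q → ∃ λ p → p ≤ B × factorAt s p n ≡ factorAt s q n
  factor-positions-bounded (L , _ , sound , complete , _) =
    let B , bounded = witnesses-bounded L (sound _) in B , λ q → bounded (complete q)

  periodicFrom⇒early-occurrence : 1 ≤ P → PeriodicFrom Q P → ∀ n j → ∃ λ r → r < Q + P × factorAt s r n ≡ factorAt s j n
  periodicFrom⇒early-occurrence {P = P} {Q = Q} 1≤P periodic n = <-rec _ step
    where
    step : ∀ j → (∀ {j'} → j' < j → ∃ λ r → r < Q + P × factorAt s r n ≡ factorAt s j' n) →
           ∃ λ r → r < Q + P × factorAt s r n ≡ factorAt s j n
    step j earlier with j <? Q + P
    ... | yes j<Q+P = j , j<Q+P , refl
    ... | no j≮Q+P =
      let r , r<Q+P , eq = earlier j∸P<j in r , r<Q+P , trans eq (sym shift)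
      where
      P≤j : P ≤ j
      P≤j = m+n≤o⇒n≤o Q (≮⇒≥ j≮Q+P)
      j∸P<j : j ∸ P < j
      j∸P<j = ∸-monoʳ-< 1≤P P≤j
      shift : factorAt s j n ≡ factorAt s (j ∸ P) n
      shift = letter-≡⇒factorAt-≡ n λ i _ → begin
        s (j + i)           ≡⟨ cong (λ x → s (x + i)) (sym (m∸n+n≡m P≤j)) ⟩
        s (j ∸ P + P + i)   ≡⟨ cong s (xy∙z≈xz∙y (j ∸ P) P i) ⟩
        s (j ∸ P + i + P)   ≡⟨ periodic (j ∸ P + i) (≤-trans (m+n≤o⇒m≤o∸n Q (≮⇒≥ j≮Q+P)) (m≤m+n _ i)) ⟩
        s (j ∸ P + i)       ∎
        where open ≡-Reasoning

  periodicFrom⇒complexity≤ : 1 ≤ P → PeriodicFrom Q P → ComplexityIs s n c → c ≤ Q + P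
  periodicFrom⇒complexity≤ {P = P} {Q = Q} {n = n} {c = c} 1≤P periodic (L , L-unique , sound , _ , |L|≡c) = begin
    c                                      ≡⟨ |L|≡c ⟨
    length L                               ≤⟨ Unique-⊆⇒length≤ L-unique L⊆early ⟩
    length (map occurrence (upTo (Q + P))) ≡⟨ trans (length-map occurrence (upTo (Q + P))) (length-upTo (Q + P)) ⟩
    Q + P                                  ∎
    where
    open ≤-Reasoning
    occurrence : ℕ → List (Fin m)
    occurrence r = factorAt s r n
    L⊆early : ∀ {w} → w ∈ L → w ∈ map occurrence (upTo (Q + P))
    L⊆early {w} w∈L =
      let j , j-occ = sound w w∈L
          r , r<Q+P , r-occ = periodicFrom⇒early-occurrence 1≤P periodic n j
      in subst (_∈ _) (trans r-occ j-occ) (∈-map⁺ occurrence (∈-upTo⁺ r<Q+P))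

  right-special-unique : ComplexityIs s n c → ComplexityIs s (suc n) (suc c) →
                         RightSpecial n q q' → RightSpecial n p p' → factorAt s q n ≡ factorAt s p n
  right-special-unique {n = n} {c = c} {q = q} {p = p} (L , L-unique , sound , complete , |L|≡c) (L⁺ , _ , _ , complete⁺ , |L⁺|≡1+c) rs rs' =
    decidable-stable (≡-dec _≟_ _ _) λ u≢v → <-irrefl refl (begin-strict
      suc c                                      <⟨ n<1+n (suc c) ⟩
      suc (suc c)                                ≡⟨ cong (suc ∘ suc) (trans (length-map extend L) |L|≡c) ⟨
      length (new rs ∷ new rs' ∷ map extend L)   ≤⟨ Unique-⊆⇒length≤ (all-unique u≢v) all⊆L⁺ ⟩
      length L⁺                                  ≡⟨ |L⁺|≡1+c ⟩
      suc c                                      ∎)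
    where
    open ≤-Reasoning
    open import Data.List.Membership.DecPropositional (≡-dec _≟_) using (_∈?_)

    -- junk value 0 for words outside L
    occurrence : List (Fin m) → ℕ
    occurrence w with w ∈? L
    ... | yes w∈L = proj₁ (sound w w∈L)
    ... | no _    = 0

    occurrence-correct : ∀ {w} → w ∈ L → factorAt s (occurrence w) n ≡ w
    occurrence-correct {w} w∈L with w ∈? L
    ... | yes w∈L′ = proj₂ (sound w w∈L′)
    ... | no w∉L   = contradiction w∈L w∉L

    extend : List (Fin m) → List (Fin m)
    extend w = w ∷ʳ s (occurrence w + n)

    extend∈L⁺ : ∀ {w} → w ∈ L → extend w ∈ L⁺
    extend∈L⁺ {w} w∈L = subst (_∈ L⁺)
      (trans (factorAt-suc (occurrence w) n) (cong (_∷ʳ s (occurrence w + n)) (occurrence-correct w∈L)))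
      (complete⁺ (occurrence w))

    Fresh : ℕ → Set
    Fresh a = s (a + n) ≢ s (occurrence (factorAt s a n) + n)

    fresh-occurrence : ∀ {q q'} → RightSpecial n q q' → ∃ λ a → factorAt s a n ≡ factorAt s q n × Fresh a
    fresh-occurrence {q} {q'} (same , differ) with s (q + n) ≟ s (occurrence (factorAt s q n) + n)
    ... | yes eq = q' , sym same , λ eq' → differ (trans eq (trans (cong (λ w → s (occurrence w + n)) same) (sym eq')))
    ... | no neq = q , refl , neq

    new : ∀ {q q'} → RightSpecial n q q' → List (Fin m)
    new rs = factorAt s (proj₁ (fresh-occurrence rs)) (suc n)

    new-prefix : ∀ {q q'} (rs : RightSpecial n q q') → ∃ λ x → new rs ≡ factorAt s q n ∷ʳ x
    new-prefix {q} rs = let a , same , _ = fresh-occurrence rs in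
      s (a + n) , trans (factorAt-suc a n) (cong (_∷ʳ s (a + n)) same)

    new∉extended : ∀ {q q'} (rs : RightSpecial n q q') → new rs ∉ map extend L
    new∉extended rs new∈ with fresh-occurrence rs | ∈-map⁻ extend new∈
    ... | a , _ , fresh | w , _ , eq with ∷ʳ-injective (factorAt s a n) w (trans (sym (factorAt-suc a n)) eq)
    ...   | refl , letter = fresh letter

    all-unique : factorAt s q n ≢ factorAt s p n → Unique (new rs ∷ new rs' ∷ map extend L)
    all-unique u≢v = ((λ eq → u≢v (∷ʳ-injectiveˡ _ _ (trans (sym (proj₂ (new-prefix rs))) (trans eq (proj₂ (new-prefix rs'))))))
                       ∷ ¬Any⇒All¬ _ (new∉extended rs))
                   ∷ ¬Any⇒All¬ _ (new∉extended rs')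
                   ∷ map⁺ (∷ʳ-injectiveˡ _ _) L-unique

    all⊆L⁺ : ∀ {w} → w ∈ new rs ∷ new rs' ∷ map extend L → w ∈ L⁺
    all⊆L⁺ (here refl)                = complete⁺ _
    all⊆L⁺ (there (here refl))        = complete⁺ _
    all⊆L⁺ (there (there w∈extended)) with ∈-map⁻ extend w∈extended
    ... | w , w∈L , refl = extend∈L⁺ w∈L

  segment-propagates : factorAt s j L ≡ factorAt s (j + ℓ) L → n ≤ L →
                       (∀ q → j ≤ q → factorAt s q n ≡ factorAt s (q + ℓ) n → PeriodAt ℓ (q + n)) →
                       PeriodicFrom j ℓ
  segment-propagates {j = j} {L = L} {ℓ = ℓ} {n = n} segment n≤L extends x j≤x =
    subst (PeriodAt ℓ) (m+[n∸m]≡n j≤x) (<-rec _ step (x ∸ j))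
    where
    step : ∀ d → (∀ {d'} → d' < d → PeriodAt ℓ (j + d')) → PeriodAt ℓ (j + d)
    step d earlier with d <? L
    ... | yes d<L = shift-invariant⇒PeriodAt segment d<L
    ... | no d≮L = subst (PeriodAt ℓ) (trans (+-assoc j e n) (cong (j +_) e+n≡d)) (extends (j + e) (m≤m+n j e) window)
      where
      n≤d : n ≤ d
      n≤d = ≤-trans n≤L (≮⇒≥ d≮L)
      e : ℕ
      e = d ∸ n
      e+n≡d : e + n ≡ d
      e+n≡d = m∸n+n≡m n≤d
      window : factorAt s (j + e) n ≡ factorAt s (j + e + ℓ) n
      window = letter-≡⇒factorAt-≡ n λ i i<n → begin
        s (j + e + i)       ≡⟨ cong s (+-assoc j e i) ⟩
        s (j + (e + i))     ≡⟨ earlier (subst (e + i <_) e+n≡d (+-monoʳ-< e i<n)) ⟨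
        s (j + (e + i) + ℓ) ≡⟨ cong (λ y → s (y + ℓ)) (+-assoc j e i) ⟨
        s (j + e + i + ℓ)   ≡⟨ cong s (xy∙z≈xz∙y (j + e) i ℓ) ⟩
        s (j + e + ℓ + i)   ∎
        where open ≡-Reasoning

  recurrent-factor⇒periodic : ∀ {N δ q₀} .{{_ : NonZero δ}} →
    factorAt s (q₀ + δ) N ≡ factorAt s q₀ N →
    (∀ a a' → factorAt s a N ≡ factorAt s q₀ N → factorAt s a' N ≡ factorAt s q₀ N →
              factorAt s a (N + δ) ≡ factorAt s a' (N + δ)) →
    PeriodicFrom q₀ δ
  recurrent-factor⇒periodic {N} {δ} {q₀} recurs rigid x q₀≤x =
    subst (PeriodAt δ) start+r≡x (shift-invariant⇒PeriodAt (rigid start (start + δ) (occurs t) (occurs-step (occurs t))) r<N+δ)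
    where
    Occurs : ℕ → Set
    Occurs a = factorAt s a N ≡ factorAt s q₀ N

    occurs-step : ∀ {a} → Occurs a → Occurs (a + δ)
    occurs-step {a} occ = trans (factorAt-≡-infix (rigid a q₀ occ refl) (≤-reflexive (+-comm δ N))) recurs

    occurs : ∀ c → Occurs (q₀ + c * δ)
    occurs zero    = cong (λ y → factorAt s y N) (+-identityʳ q₀)
    occurs (suc c) = subst Occurs (trans (+-assoc q₀ (c * δ) δ) (cong (q₀ +_) (+-comm (c * δ) δ))) (occurs-step (occurs c))

    y r t start : ℕ
    y = x ∸ q₀
    r = y % δ
    t = y / δ
    start = q₀ + t * δ

    start+r≡x : start + r ≡ x
    start+r≡x = begin
      q₀ + t * δ + r   ≡⟨ +-assoc q₀ (t * δ) r ⟩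
      q₀ + (t * δ + r) ≡⟨ cong (q₀ +_) (+-comm (t * δ) r) ⟩
      q₀ + (r + t * δ) ≡⟨ cong (q₀ +_) (m≡m%n+[m/n]*n y δ) ⟨
      q₀ + y           ≡⟨ m+[n∸m]≡n q₀≤x ⟩
      x                ∎
      where open ≡-Reasoning

    r<N+δ : r < N + δ
    r<N+δ = ≤-trans (m%n<n y δ) (m≤n+m δ N)

  ¬PeriodicFrom⇒bounded-defect : ∀ {B M} →
    (∀ q → ∃ λ p → p ≤ B × factorAt s p (suc (M + ℓ)) ≡ factorAt s q (suc (M + ℓ))) →
    ¬ PeriodicFrom M ℓ → ∃ λ z → z ≤ B × ¬ PeriodAt ℓ (z + M)
  ¬PeriodicFrom⇒bounded-defect {ℓ = ℓ} {B} {M} early aperiodic with anyUpTo? (λ z → ¬? (s (z + M + ℓ) ≟ s (z + M))) (suc B)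
  ... | yes (z , z<1+B , defect) = z , s≤s⁻¹ z<1+B , defect
  ... | no no-defect = contradiction periodic aperiodic
    where
    periodic : PeriodicFrom M ℓ
    periodic x M≤x =
      let p , p≤B , same = early (x ∸ M)
          period-at-p = decidable-stable (s (p + M + ℓ) ≟ s (p + M)) λ defect → no-defect (p , s≤s p≤B , defect)
      in subst (PeriodAt ℓ) (m∸n+n≡m M≤x) (PeriodAt-transfer (sym same) (n<1+n (M + ℓ)) period-at-p)

  power-factor⇒shift-invariant : ∀ (W : List (Fin m)) t → factorAt s j (length (W ^^ suc t)) ≡ W ^^ suc t →
                                 factorAt s j (length (W ^^ t)) ≡ factorAt s (j + length W) (length (W ^^ t))
  power-factor⇒shift-invariant {j = j} W t occ =
    trans (proj₁ (factorAt-++ (W ^^ t) W j occ′)) (sym (proj₂ (factorAt-++ W (W ^^ t) j occ)))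
    where
    occ′ : factorAt s j (length (W ^^ t ++ W)) ≡ W ^^ t ++ W
    occ′ = subst (λ V → factorAt s j (length V) ≡ V) (^^-suc W t) occ

module QuasiSturmianWord {m k n₀ : ℕ} {s : InfWord m} (1≤k : 1 ≤ k)
                         (complexity : ∀ n → n₀ ≤ n → ComplexityIs s n (n + k)) where

  aperiodic : 1 ≤ P → ¬ PeriodicFrom s Q P
  aperiodic {P = P} {Q = Q} 1≤P periodic = <-irrefl refl (begin-strict
    Q + P            ≤⟨ m≤n+m (Q + P) n₀ ⟩
    n₀ + (Q + P)     <⟨ m<m+n (n₀ + (Q + P)) 1≤k ⟩
    n₀ + (Q + P) + k ≤⟨ periodicFrom⇒complexity≤ s 1≤P periodic (complexity (n₀ + (Q + P)) (m≤m+n n₀ (Q + P))) ⟩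
    Q + P            ∎)
    where open ≤-Reasoning

  module PeriodicSegment {ℓ j L : ℕ} (1≤ℓ : 1 ≤ ℓ) (segment : factorAt s j L ≡ factorAt s (j + ℓ) L) where

    right-special-periodic : n₀ ≤ n → n ≤ L → RightSpecial s n q q' → i + ℓ < n → PeriodAt s ℓ (q + i)
    right-special-periodic {n = n} {q = q} {i = i} n₀≤n n≤L rs i+ℓ<n =
      decidable-stable (_ ≟ _) λ defect → aperiodic 1≤ℓ (segment-propagates s segment n≤L (extends defect))
      where
      extends : ¬ PeriodAt s ℓ (q + i) → ∀ p → j ≤ p → factorAt s p n ≡ factorAt s (p + ℓ) n → PeriodAt s ℓ (p + n)
      extends defect p _ shifted = decidable-stable (_ ≟ _) λ not-periodic →
        let p-right-special = shifted , λ eq → not-periodic (trans (cong s (xy∙z≈xz∙y p n ℓ)) (sym eq))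
            same = right-special-unique s (complexity n n₀≤n) (complexity (suc n) (m≤n⇒m≤1+n n₀≤n)) rs p-right-special
        in defect (PeriodAt-transfer s same i+ℓ<n (shift-invariant⇒PeriodAt s shifted (≤-trans (s≤s (m≤m+n i ℓ)) i+ℓ<n)))

    defect-factor-rigid : ¬ PeriodAt s ℓ (a + n₀) → factorAt s a (suc (n₀ + ℓ)) ≡ factorAt s a' (suc (n₀ + ℓ)) →
                          ∀ e → suc (n₀ + ℓ) + e ≤ L → factorAt s a (suc (n₀ + ℓ) + e) ≡ factorAt s a' (suc (n₀ + ℓ) + e)
    defect-factor-rigid {a = a} {a' = a'} _ same zero _ =
      subst (λ n → factorAt s a n ≡ factorAt s a' n) (sym (+-identityʳ (suc (n₀ + ℓ)))) same
    defect-factor-rigid {a = a} {a' = a'} defect same (suc e) bound =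
      subst (λ len → factorAt s a len ≡ factorAt s a' len) (sym (+-suc (suc (n₀ + ℓ)) e)) (begin
        factorAt s a (suc len)            ≡⟨ factorAt-suc s a len ⟩
        factorAt s a len ∷ʳ s (a + len)   ≡⟨ cong₂ _∷ʳ_ shorter next ⟩
        factorAt s a' len ∷ʳ s (a' + len) ≡⟨ factorAt-suc s a' len ⟨
        factorAt s a' (suc len)           ∎)
      where
      open ≡-Reasoning
      len : ℕ
      len = suc (n₀ + ℓ) + e
      len≤L : len ≤ L
      len≤L = ≤-trans (n≤1+n len) (subst (_≤ L) (+-suc (suc (n₀ + ℓ)) e) bound)
      n₀≤len : n₀ ≤ len
      n₀≤len = ≤-trans (m≤m+n n₀ ℓ) (≤-trans (n≤1+n (n₀ + ℓ)) (m≤m+n (suc (n₀ + ℓ)) e))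
      shorter : factorAt s a len ≡ factorAt s a' len
      shorter = defect-factor-rigid defect same e len≤L
      next : s (a + len) ≡ s (a' + len)
      next = decidable-stable (_ ≟ _) λ differ →
        defect (right-special-periodic n₀≤len len≤L (shorter , differ) (s≤s (m≤m+n (n₀ + ℓ) e)))

    recurring-defect-factor⇒⊥ : ∀ {z q₀} → ¬ PeriodAt s ℓ (z + n₀) → q₀ < z →
      factorAt s q₀ (suc (n₀ + ℓ)) ≡ factorAt s z (suc (n₀ + ℓ)) → suc (n₀ + ℓ) + (z ∸ q₀) ≤ L → ⊥
    recurring-defect-factor⇒⊥ {z} {q₀} defect q₀<z same bound =
      aperiodic 1≤δ (recurrent-factor⇒periodic s ⦃ >-nonZero 1≤δ ⦄ recurs rigid)
      where
      N δ : ℕ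
      N = suc (n₀ + ℓ)
      δ = z ∸ q₀
      1≤δ : 1 ≤ δ
      1≤δ = m<n⇒0<n∸m q₀<z
      recurs : factorAt s (q₀ + δ) N ≡ factorAt s q₀ N
      recurs = trans (cong (λ y → factorAt s y N) (m+[n∸m]≡n (<⇒≤ q₀<z))) (sym same)
      defect₀ : ¬ PeriodAt s ℓ (q₀ + n₀)
      defect₀ = defect ∘ PeriodAt-transfer s (sym same) (n<1+n (n₀ + ℓ))
      rigid : ∀ a a' → factorAt s a N ≡ factorAt s q₀ N → factorAt s a' N ≡ factorAt s q₀ N →
              factorAt s a (N + δ) ≡ factorAt s a' (N + δ)
      rigid a a' occ occ' =
        defect-factor-rigid (defect₀ ∘ PeriodAt-transfer s (sym occ) (n<1+n (n₀ + ℓ))) (trans occ (sym occ')) δ bound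

  periodic-factor-length-bounded : 1 ≤ ℓ → ∃ λ T → ∀ j L → T ≤ L → factorAt s j L ≢ factorAt s (j + ℓ) L
  periodic-factor-length-bounded {ℓ = ℓ} 1≤ℓ =
    let B₁ , early₁ = factor-positions-bounded s (complexity (suc (n₀ + ℓ)) (≤-trans (m≤m+n n₀ ℓ) (n≤1+n _)))
        -- positions ≥ M₀ lie beyond every first occurrence of a factor of length n₀ + ℓ + 1
        M₀ = suc B₁
        B₂ , early₂ = factor-positions-bounded s
          (complexity (suc (M₀ + n₀ + ℓ)) (≤-trans (m≤n+m n₀ M₀) (≤-trans (m≤m+n _ ℓ) (n≤1+n _))))
        z , z≤B₂ , defect = ¬PeriodicFrom⇒bounded-defect s early₂ (aperiodic 1≤ℓ)
    in suc (n₀ + ℓ) + (B₂ + M₀) , λ j L T≤L segment →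
      let q₀ , q₀≤B₁ , same = early₁ (z + M₀)
          δ≤B₂+M₀ = ≤-trans (m∸n≤m (z + M₀) q₀) (+-monoˡ-≤ M₀ z≤B₂)
      in PeriodicSegment.recurring-defect-factor⇒⊥ 1≤ℓ segment
           (defect ∘ subst (PeriodAt s ℓ) (+-assoc z M₀ n₀))
           (≤-trans (s≤s q₀≤B₁) (m≤n+m M₀ z))
           same
           (≤-trans (+-monoʳ-≤ (suc (n₀ + ℓ)) δ≤B₂+M₀) T≤L)

lemma2p3 : {m : ℕ} (s : InfWord m) (W : List (Fin m)) →
    QuasiSturmian s → 0 < length W → IsFactor W s →
    ∃ λ t → (1 ≤ t) × ¬ IsFactor (W ^^ t) s
lemma2p3 s W (k , n₀ , 1≤k , _ , complexity) 0<|W| _ =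
  suc T , s≤s z≤n , λ (j , occurrence) →
    no-periodic-factor j (length (W ^^ T)) T≤|W^T| (power-factor⇒shift-invariant s W T occurrence)
  where
  open QuasiSturmianWord 1≤k complexity
  T : ℕ
  T = proj₁ (periodic-factor-length-bounded 0<|W|)
  no-periodic-factor : ∀ j L → T ≤ L → factorAt s j L ≢ factorAt s (j + length W) L
  no-periodic-factor = proj₂ (periodic-factor-length-bounded 0<|W|)
  T≤|W^T| : T ≤ length (W ^^ T)
  T≤|W^T| = subst (T ≤_) (sym (length-^^ W T)) (m≤m*n T (length W) ⦃ >-nonZero 0<|W| ⦄)
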